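{- Let $X$ be a sequential space that is sequentially Hausdorff. Then: (1) The function $\mathit{neq}\colon X\times X\to\mathbb{S}$ with $\mathit{neq}(x,y)=\top$ iff $x\neq y$ is sequentially continuous. (2) The map $x\mapsto X\setminus\{x\}$ is a continuous function from $X$ to $\mathcal{O}(X)$. (3) The map $H\mapsto X\setminus\bigcap(H)$ is a continuous function from $\mathcal{O}(\mathcal{O}(X))$ to $\mathcal{O}(X)$. (4) If $(H_n)_n$ converges to $H_\infty$ in $\mathcal{O}(\mathcal{O}(X))$, $(x_n)_n$ converges to $x_\infty$ in $X$, and $x_n\in\bigcap(H_n)$ for all $n\in\mathbb{N}$, then $x_\infty\in\bigcap(H_\infty)$.
   Context: A sequential space is one in which every sequentially open set is open; it is sequentially Hausdorff if every convergent sequence has a unique limit. $X\times X$ carries the sequentialisation of the product topology. $\mathbb{S}$ is Sierpiński space $\{\top,\bot\}$ with $\{\top\}$ open but not $\{\bot\}$. For a sequential space $Z$, $\mathcal{O}(Z)$ is the set of open subsets of $Z$ with the $\omega$-Scott topology: $H\subseteq\mathcal{O}(Z)$ is open iff $H$ is upward closed under inclusion and $H\cap\mathcal{D}\neq\emptyset$ for every countable directed family $\mathcal{D}\subseteq\mathcal{O}(Z)$ with $\bigcup\mathcal{D}\in H$. This space is sequential, so $\mathcal{O}(\mathcal{O}(X))$ is the set of $\omega$-Scott open subsets of $\mathcal{O}(X)$ with the $\omega$-Scott topology on that lattice. $\bigcap(H)$ denotes the intersection of all members of $H$ (equal to $X$ if $H=\emptyset$). -}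

module Defs where

open import Level using (0ℓ)
open import Data.Bool using (Bool; true; false; _∧_)
open import Data.Nat using (ℕ; _≤_)
open import Data.Product using (Σ; ∃; ∃-syntax; _×_; _,_; proj₁; proj₂)
open import Function.Bundles using (_⇔_)
open import Relation.Nullary using (¬_; Dec; yes; no)
open import Relation.Nullary.Decidable using (⌊_⌋)
open import Relation.Binary.PropositionalEquality using (_≡_)
open import Axiom.ExcludedMiddle using (ExcludedMiddle)

-- Subsets are Bool-valued (classical reading).
-- A "space" is a carrier together with its family of open subsets.
record Space : Set₁ where
  field
    Carrier : Set
    Open    : (Carrier → Bool) → Set
open Space public

Subset : Set → Set
Subset A = A → Bool

_⊆_ : {A : Set} → Subset A → Subset A → Set
U ⊆ V = ∀ x → U x ≡ true → V x ≡ true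

record IsTopology (X : Space) : Set₁ where
  field
    open-full  : Open X (λ _ → true)
    open-inter : ∀ U V → Open X U → Open X V → Open X (λ x → U x ∧ V x)
    open-union : (I : Set) (U : I → Subset (Carrier X)) (V : Subset (Carrier X)) →
                 (∀ i → Open X (U i)) →
                 (∀ x → (V x ≡ true) ⇔ (∃[ i ] (U i x ≡ true))) →
                 Open X V

Eventually : (ℕ → Set) → Set
Eventually P = ∃[ N ] (∀ n → N ≤ n → P n)

Converges : (X : Space) → (ℕ → Carrier X) → Carrier X → Set
Converges X s x = ∀ U → Open X U → U x ≡ true → Eventually (λ n → U (s n) ≡ true)

SeqOpen : (X : Space) → Subset (Carrier X) → Set
SeqOpen X U = ∀ s x → Converges X s x → U x ≡ true → Eventually (λ n → U (s n) ≡ true)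

IsSequential : Space → Set
IsSequential X = ∀ U → SeqOpen X U → Open X U

SeqHausdorff : Space → Set
SeqHausdorff X = ∀ s x y → Converges X s x → Converges X s y → x ≡ y

Continuous : (X Y : Space) → (Carrier X → Carrier Y) → Set
Continuous X Y f = ∀ V → Open Y V → Open X (λ x → V (f x))

SeqContinuous : (X Y : Space) → (Carrier X → Carrier Y) → Set
SeqContinuous X Y f = ∀ s x → Converges X s x → Converges Y (λ n → f (s n)) (f x)

ProdTop : Space → Space
ProdTop X = record
  { Carrier = Carrier X × Carrier X
  ; Open = λ W → ∀ p → W p ≡ true →
      Σ (Subset (Carrier X)) λ A → Σ (Subset (Carrier X)) λ B →
        Open X A × Open X B × A (proj₁ p) ≡ true × B (proj₂ p) ≡ true ×
        (∀ q → A (proj₁ q) ≡ true → B (proj₂ q) ≡ true → W q ≡ true) }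

Seqz : Space → Space
Seqz X = record { Carrier = Carrier X ; Open = SeqOpen X }

XxX : Space → Space
XxX X = Seqz (ProdTop X)

-- Sierpiński space: true = ⊤, false = ⊥; opens are ∅, {⊤}, {⊤,⊥}
Sierpinski : Space
Sierpinski = record { Carrier = Bool ; Open = λ U → U false ≡ true → U true ≡ true }

Directed : {Z : Space} → (ℕ → Σ (Subset (Carrier Z)) (Open Z)) → Set
Directed D = ∀ i j → ∃[ k ] (proj₁ (D i) ⊆ proj₁ (D k) × proj₁ (D j) ⊆ proj₁ (D k))

IsUnion : {Z : Space} → (ℕ → Σ (Subset (Carrier Z)) (Open Z)) → Σ (Subset (Carrier Z)) (Open Z) → Set
IsUnion {Z} D U = ∀ z → (proj₁ U z ≡ true) ⇔ (∃[ n ] (proj₁ (D n) z ≡ true))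

ωScottOpen : (Z : Space) → Subset (Σ (Subset (Carrier Z)) (Open Z)) → Set
ωScottOpen Z H =
  (∀ U V → proj₁ U ⊆ proj₁ V → H U ≡ true → H V ≡ true) ×
  (∀ (D : ℕ → Σ (Subset (Carrier Z)) (Open Z)) (U : Σ (Subset (Carrier Z)) (Open Z)) →
     Directed {Z} D → IsUnion {Z} D U → H U ≡ true → ∃[ n ] (H (D n) ≡ true))

𝒪 : Space → Space
𝒪 Z = record { Carrier = Σ (Subset (Carrier Z)) (Open Z) ; Open = ωScottOpen Z }

module Classical (lem : ExcludedMiddle 0ℓ) where

  decide : (P : Set) → Bool
  decide P = ⌊ lem {P} ⌋

  neq : (X : Space) → Carrier X × Carrier X → Bool
  neq X (x , y) = decide (¬ (x ≡ y))

  coSingleton : (X : Space) → Carrier X → Subset (Carrier X)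
  coSingleton X x y = decide (¬ (y ≡ x))

  -- ⋂(H): intersection of all members of H (X if H = ∅)
  ⋂ : (X : Space) → Carrier (𝒪 (𝒪 X)) → Subset (Carrier X)
  ⋂ X H x = decide (∀ (U : Carrier (𝒪 X)) → proj₁ H U ≡ true → proj₁ U x ≡ true)

  co⋂ : (X : Space) → Carrier (𝒪 (𝒪 X)) → Subset (Carrier X)
  co⋂ X H x = decide (¬ (⋂ X H x ≡ true))

-- For a sequence t → x in a sequentially Hausdorff space, the sets
-- Uₙ = X ∖ ({x} ∪ {t_k | k ≥ n}) are open (a limit of points of {x} ∪ {t_k | k ≥ n}
-- either comes from arbitrarily late tails, hence is x, or from finitely many t_k),
-- increase, and exhaust X ∖ {x}.  So an ω-Scott open family containing X ∖ {x}
-- contains some Uₙ, which avoids every t_k with k ≥ n: this is continuity of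
-- x ↦ X ∖ {x}.  Since x ∈ ⋂(H) iff X ∖ {x} ∉ H, the set X ∖ ⋂(H) is the preimage
-- of H under this map, which gives (3); (4) follows by testing the convergence
-- Hₙ → H∞ on the ω-Scott open set {H | Uₙ ∈ H}.
module Submission where

open import Defs
open import Level using (0ℓ)
open import Data.Bool using (Bool; true; false)
open import Data.Bool.Properties using (T-≡)
open import Data.Nat using (ℕ; zero; suc; _≤_; _<_; _⊔_; s≤s⁻¹; _≤?_)
open import Data.Nat.Properties using (≤-refl; ≤-trans; m≤m⊔n; m≤n⊔m; ≤∧≢⇒<; m<n⇒m<1+n; _≟_; ≰⇒>)
open import Data.Product using (Σ; ∃-syntax; _×_; _,_; proj₁; proj₂)
open import Data.Sum using (_⊎_; inj₁; inj₂)
open import Data.Empty using (⊥-elim)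
open import Data.Unit using (⊤; tt)
open import Function using (_∘_)
open import Function.Bundles using (_⇔_; mk⇔; Equivalence)
open import Relation.Nullary using (¬_; yes; no)
open import Relation.Nullary.Decidable using (toWitness; fromWitness; decidable-stable)
open import Relation.Binary.PropositionalEquality using (_≡_; refl; sym; trans; subst)
open import Axiom.ExcludedMiddle using (ExcludedMiddle)

open Equivalence using (to; from)

Frequently : (ℕ → Set) → Set
Frequently P = ∀ N → ∃[ n ] (N ≤ n × P n)

Tail : {A : Set} → (ℕ → A) → ℕ → A → Set
Tail t N a = ∃[ k ] (N ≤ k × a ≡ t k)

-- Only eventual membership is assumed; this is equivalent to the usual notion
-- and is what the case distinctions below produce.
SeqClosed : (X : Space) → (Carrier X → Set) → Set
SeqClosed X P = ∀ s x → Converges X s x → Eventually (P ∘ s) → P x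

Eventually-∧ : {P Q : ℕ → Set} → Eventually P → Eventually Q → Eventually (λ n → P n × Q n)
Eventually-∧ (M , p) (N , q) = M ⊔ N , λ n le →
  p n (≤-trans (m≤m⊔n M N) le) , q n (≤-trans (m≤n⊔m M N) le)

Frequently-Eventually⇒∃ : {P Q : ℕ → Set} → Frequently P → Eventually Q → ∃[ n ] (P n × Q n)
Frequently-Eventually⇒∃ fr (N , q) with fr N
... | n , N≤n , p = n , p , q n N≤n

module _ {X : Space} where

  Converges-subseq : {s : ℕ → Carrier X} {x : Carrier X} (m : ℕ → ℕ) → (∀ k → k ≤ m k) →
                     Converges X s x → Converges X (s ∘ m) x
  Converges-subseq m k≤m c U U-open Ux with c U U-open Ux
  ... | N , ev = N , λ k N≤k → ev (m k) (≤-trans N≤k (k≤m k))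

  Converges-eventually-≡ : {s s′ : ℕ → Carrier X} {x : Carrier X} →
                           Eventually (λ n → s n ≡ s′ n) → Converges X s x → Converges X s′ x
  Converges-eventually-≡ eq c U U-open Ux with Eventually-∧ eq (c U U-open Ux)
  ... | N , ev = N , λ n le → let (e , Usn) = ev n le in subst (λ w → U w ≡ true) e Usn

  Converges-const : {x : Carrier X} → Converges X (λ _ → x) x
  Converges-const U U-open Ux = 0 , λ _ _ → Ux

  Frequently⇒limit : {P : Carrier X → Set} {s : ℕ → Carrier X} {x : Carrier X} →
                     SeqClosed X P → Converges X s x → Frequently (P ∘ s) → P x
  Frequently⇒limit closed c fr =
    closed _ _ (Converges-subseq (proj₁ ∘ fr) (proj₁ ∘ proj₂ ∘ fr) c)
               (0 , λ N _ → proj₂ (proj₂ (fr N)))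

  Converges-along-tails : {t e : ℕ → Carrier X} {x : Carrier X} → Converges X t x →
                          (∀ N → e N ≡ x ⊎ Tail t N (e N)) → Converges X e x
  Converges-along-tails {t} {e} {x} c e∈tail U U-open Ux with c U U-open Ux
  ... | M , ev = M , λ N M≤N → in-U N M≤N (e∈tail N)
    where
    in-U : ∀ N → M ≤ N → e N ≡ x ⊎ Tail t N (e N) → U (e N) ≡ true
    in-U N _   (inj₁ eq)             = subst (λ w → U w ≡ true) (sym eq) Ux
    in-U N M≤N (inj₂ (k , N≤k , eq)) = subst (λ w → U w ≡ true) (sym eq) (ev k (≤-trans M≤N N≤k))

  Open-resp : IsTopology X → {U V : Subset (Carrier X)} → Open X U →
              (∀ x → (V x ≡ true) ⇔ (U x ≡ true)) → Open X V
  Open-resp T {U} U-open V⇔U = IsTopology.open-union T ⊤ (λ _ → U) _ (λ _ → U-open)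
    λ x → mk⇔ (λ Vx → tt , to (V⇔U x) Vx) (λ (_ , Ux) → from (V⇔U x) Ux)

module _ {X : Space} (T : IsTopology X) where
  open IsTopology T

  Converges-proj₁ : {s : ℕ → Carrier X × Carrier X} {p : Carrier X × Carrier X} →
                    Converges (ProdTop X) s p → Converges X (proj₁ ∘ s) (proj₁ p)
  Converges-proj₁ c U U-open Ua =
    c (U ∘ proj₁) (λ _ Uq → U , (λ _ → true) , U-open , open-full , Uq , refl , λ _ u _ → u) Ua

  Converges-proj₂ : {s : ℕ → Carrier X × Carrier X} {p : Carrier X × Carrier X} →
                    Converges (ProdTop X) s p → Converges X (proj₂ ∘ s) (proj₂ p)
  Converges-proj₂ c U U-open Ub =
    c (U ∘ proj₂) (λ _ Uq → (λ _ → true) , U , open-full , U-open , refl , Uq , λ _ _ u → u) Ub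

Open⇒SeqContinuous-Sierpinski : {Y : Space} {f : Carrier Y → Bool} → Open Y f →
                                 SeqContinuous Y Sierpinski f
Open⇒SeqContinuous-Sierpinski {f = f} f-open s y c U U-open Ufy with f y in fy
... | true  = let (N , ev) = c f f-open fy in
              N , λ n le → subst (λ b → U b ≡ true) (sym (ev n le)) Ufy
... | false = 0 , λ n _ → everywhere (f (s n))
  where
  everywhere : ∀ b → U b ≡ true
  everywhere true  = U-open Ufy
  everywhere false = Ufy

point-ωScottOpen : (Z : Space) (z : Carrier Z) → ωScottOpen Z (λ V → proj₁ V z)
point-ωScottOpen Z z = (λ U V U⊆V → U⊆V z) , (λ D U _ union Uz → to (union z) Uz)

ωScott-continuous : {Y Z : Space} (f : Carrier (𝒪 Y) → Carrier (𝒪 Z)) →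
                    (∀ U V → proj₁ U ⊆ proj₁ V → proj₁ (f U) ⊆ proj₁ (f V)) →
                    (∀ D U → IsUnion {Y} D U → IsUnion {Z} (f ∘ D) (f U)) →
                    Continuous (𝒪 Y) (𝒪 Z) f
ωScott-continuous f mono union G (G-up , G-scott) =
  (λ U V U⊆V → G-up (f U) (f V) (mono U V U⊆V)) ,
  λ D U directed D∪ → G-scott (f ∘ D) (f U) (f-directed D directed) (union D U D∪)
  where
  f-directed : ∀ D → Directed D → Directed (f ∘ D)
  f-directed D directed i j =
    let (k , i⊆k , j⊆k) = directed i j in
    k , mono (D i) (D k) i⊆k , mono (D j) (D k) j⊆k

module WithExcludedMiddle (lem : ExcludedMiddle 0ℓ) where
  open Classical lem

  decide≡true⇒ : {P : Set} → decide P ≡ true → P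
  decide≡true⇒ e = toWitness (from T-≡ e)

  ⇒decide≡true : {P : Set} → P → decide P ≡ true
  ⇒decide≡true p = to T-≡ (fromWitness p)

  dne : {P : Set} → ¬ ¬ P → P
  dne = decidable-stable lem

  decide¬≢true⇒ : {P : Set} → ¬ (decide (¬ P) ≡ true) → P
  decide¬≢true⇒ nd = dne (nd ∘ ⇒decide≡true)

  ¬∀⇒∃¬ : {P : ℕ → Set} → ¬ (∀ n → P n) → ∃[ n ] ¬ P n
  ¬∀⇒∃¬ ¬∀ = dne λ ¬∃ → ¬∀ λ n → dne λ ¬Pn → ¬∃ (n , ¬Pn)

  ¬Frequently⇒Eventually¬ : {P : ℕ → Set} → ¬ Frequently P → Eventually (¬_ ∘ P)
  ¬Frequently⇒Eventually¬ ¬fr with ¬∀⇒∃¬ ¬fr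
  ... | N , ¬∃ = N , λ n N≤n Pn → ¬∃ (n , N≤n , Pn)

  SeqClosed⇒SeqOpen-complement : {X : Space} {P : Carrier X → Set} → SeqClosed X P →
                                 SeqOpen X (λ x → decide (¬ P x))
  SeqClosed⇒SeqOpen-complement {P = P} closed s x c ¬Px with lem {Frequently (P ∘ s)}
  ... | yes fr  = ⊥-elim (decide≡true⇒ ¬Px (Frequently⇒limit closed c fr))
  ... | no ¬fr  = let (N , ev) = ¬Frequently⇒Eventually¬ ¬fr in
                  N , λ n le → ⇒decide≡true (ev n le)

  ⊆-coSingleton : (X : Space) (U : Subset (Carrier X)) {y : Carrier X} →
                  ¬ (U y ≡ true) → U ⊆ coSingleton X y
  ⊆-coSingleton X U y∉U w Uw = ⇒decide≡true λ w≡y → y∉U (subst (λ v → U v ≡ true) w≡y Uw)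

  module _ (X : Space) (hd : SeqHausdorff X) where

    singleton-SeqClosed : (y : Carrier X) → SeqClosed X (_≡ y)
    singleton-SeqClosed y s x c ev = hd s x y c (Converges-eventually-≡ eq Converges-const)
      where
      eq : Eventually (λ n → y ≡ s n)
      eq = let (N , e) = ev in N , λ n le → sym (e n le)

    Frequently-≡⇒limit : {s : ℕ → Carrier X} {x y : Carrier X} → Converges X s x →
                         Frequently (λ n → s n ≡ y) → x ≡ y
    Frequently-≡⇒limit = Frequently⇒limit (singleton-SeqClosed _)

    diagonal-SeqClosed : IsTopology X → SeqClosed (ProdTop X) (λ p → proj₁ p ≡ proj₂ p)
    diagonal-SeqClosed T s (a , b) c diag =
      hd (proj₁ ∘ s) a b (Converges-proj₁ T c)
         (Converges-eventually-≡ (let (N , e) = diag in N , λ n le → sym (e n le))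
                                 (Converges-proj₂ T c))

    Between : (ℕ → Carrier X) → ℕ → ℕ → Carrier X → Set
    Between t N B w = ∃[ k ] (N ≤ k × k < B × w ≡ t k)

    Between-SeqClosed : (t : ℕ → Carrier X) (N B : ℕ) → SeqClosed X (Between t N B)
    Between-SeqClosed t N zero s x c (M , ev) with ev M ≤-refl
    ... | _ , _ , () , _
    Between-SeqClosed t N (suc B) s x c ev with lem {Frequently (λ n → s n ≡ t B)}
    ... | yes fr = let (n , sn≡tB , k , N≤k , k<B+1 , sn≡tk) = Frequently-Eventually⇒∃ fr ev in
                   k , N≤k , k<B+1 , trans (Frequently-≡⇒limit c fr) (trans (sym sn≡tB) sn≡tk)
    ... | no ¬fr with Between-SeqClosed t N B s x c (drop-B (Eventually-∧ ev (¬Frequently⇒Eventually¬ ¬fr)))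
      where
      drop-B : Eventually (λ n → Between t N (suc B) (s n) × ¬ s n ≡ t B) → Eventually (Between t N B ∘ s)
      drop-B (M , both) = M , λ n le → shrink (both n le)
        where
        shrink : ∀ {w} → Between t N (suc B) w × ¬ w ≡ t B → Between t N B w
        shrink ((k , N≤k , k<B+1 , w≡tk) , w≢tB) with k ≟ B
        ... | yes refl = ⊥-elim (w≢tB w≡tk)
        ... | no k≢B   = k , N≤k , ≤∧≢⇒< (s≤s⁻¹ k<B+1) k≢B , w≡tk
    ... | k , N≤k , k<B , x≡tk = k , N≤k , m<n⇒m<1+n k<B , x≡tk

    tail-SeqClosed : {t : ℕ → Carrier X} {x : Carrier X} → Converges X t x →
                     ∀ N → SeqClosed X (λ w → w ≡ x ⊎ Tail t N w)
    tail-SeqClosed {t} {x} t→x N s z c ev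
      with lem {∀ B → Frequently (λ n → s n ≡ x ⊎ Tail t B (s n))}
    ... | yes late = inj₁ (hd (s ∘ pick) z x (Converges-subseq pick (λ B → proj₁ (proj₂ (late B B))) c)
                              (Converges-along-tails t→x (λ B → proj₂ (proj₂ (late B B)))))
      where
      pick : ℕ → ℕ
      pick B = proj₁ (late B B)
    ... | no ¬late with ¬∀⇒∃¬ ¬late
    ...   | B , ¬fr = let (k , N≤k , _ , z≡tk) = Between-SeqClosed t N B s z c early in
                      inj₂ (k , N≤k , z≡tk)
      where
      early : Eventually (Between t N B ∘ s)
      early with Eventually-∧ ev (¬Frequently⇒Eventually¬ ¬fr)
      ... | M , both = M , λ n le → before-B (both n le)
        where
        before-B : ∀ {w} → (w ≡ x ⊎ Tail t N w) × ¬ (w ≡ x ⊎ Tail t B w) → Between t N B w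
        before-B (inj₁ w≡x , ¬late-w) = ⊥-elim (¬late-w (inj₁ w≡x))
        before-B (inj₂ (k , N≤k , w≡tk) , ¬late-w) with B ≤? k
        ... | yes B≤k = ⊥-elim (¬late-w (inj₂ (k , B≤k , w≡tk)))
        ... | no  B≰k = k , N≤k , ≰⇒> B≰k , w≡tk

  module Sequential (X : Space) (T : IsTopology X) (sq : IsSequential X) (hd : SeqHausdorff X) where

    SeqClosed⇒Open-complement : {P : Carrier X → Set} → SeqClosed X P → Open X (λ x → decide (¬ P x))
    SeqClosed⇒Open-complement = sq _ ∘ SeqClosed⇒SeqOpen-complement

    coSingleton-open : ∀ x → Open X (coSingleton X x)
    coSingleton-open x = SeqClosed⇒Open-complement (singleton-SeqClosed X hd x)

    X∖｛_｝ : Carrier X → Carrier (𝒪 X)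
    X∖｛ x ｝ = coSingleton X x , coSingleton-open x

    module Avoiding {t : ℕ → Carrier X} {x : Carrier X} (t→x : Converges X t x) where

      avoiding : ℕ → Carrier (𝒪 X)
      avoiding N = (λ w → decide (¬ (w ≡ x ⊎ Tail t N w))) ,
                   SeqClosed⇒Open-complement (tail-SeqClosed X hd t→x N)

      avoiding-mono : ∀ {M N} → M ≤ N → proj₁ (avoiding M) ⊆ proj₁ (avoiding N)
      avoiding-mono M≤N w e = ⇒decide≡true λ where
        (inj₁ w≡x)              → decide≡true⇒ e (inj₁ w≡x)
        (inj₂ (k , N≤k , w≡tk)) → decide≡true⇒ e (inj₂ (k , ≤-trans M≤N N≤k , w≡tk))

      avoiding-directed : Directed {X} avoiding
      avoiding-directed i j = i ⊔ j , avoiding-mono (m≤m⊔n i j) , avoiding-mono (m≤n⊔m i j)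

      -- A point y ≠ x outside every Uₙ equals t_k for arbitrarily large k, so t → y.
      avoiding-union : IsUnion {X} avoiding X∖｛ x ｝
      avoiding-union y = mk⇔ into (λ (_ , e) → ⇒decide≡true λ y≡x → decide≡true⇒ e (inj₁ y≡x))
        where
        into : coSingleton X x y ≡ true → ∃[ N ] (proj₁ (avoiding N) y ≡ true)
        into y≢x with lem {∃[ N ] (proj₁ (avoiding N) y ≡ true)}
        ... | yes found = found
        ... | no ¬found = ⊥-elim (decide≡true⇒ y≢x (sym (Frequently-≡⇒limit X hd t→x recurs)))
          where
          recurs : Frequently (λ n → t n ≡ y)
          recurs N with decide¬≢true⇒ (λ e → ¬found (N , e))
          ... | inj₁ y≡x              = ⊥-elim (decide≡true⇒ y≢x y≡x)
          ... | inj₂ (k , N≤k , y≡tk) = k , N≤k , sym y≡tk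

      avoiding-tail : ∀ {N n} → N ≤ n → ¬ (proj₁ (avoiding N) (t n) ≡ true)
      avoiding-tail {n = n} N≤n e = decide≡true⇒ e (inj₂ (n , N≤n , refl))

      ωScottOpen-avoids-tail : (𝓗 : Subset (Carrier (𝒪 X))) → ωScottOpen X 𝓗 → 𝓗 X∖｛ x ｝ ≡ true →
                               ∃[ U ] (𝓗 U ≡ true × Eventually (λ n → ¬ (proj₁ U (t n) ≡ true)))
      ωScottOpen-avoids-tail 𝓗 (_ , scott) 𝓗x with scott avoiding X∖｛ x ｝ avoiding-directed avoiding-union 𝓗x
      ... | N , 𝓗N = avoiding N , 𝓗N , N , λ n → avoiding-tail

    coSingleton-continuous : Continuous X (𝒪 X) X∖｛_｝
    coSingleton-continuous 𝓗 𝓗-open@(𝓗-up , _) = sq _ λ t x t→x 𝓗x →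
      let (U , 𝓗U , N , avoids) = Avoiding.ωScottOpen-avoids-tail t→x 𝓗 𝓗-open 𝓗x in
      N , λ n le → 𝓗-up U X∖｛ t n ｝ (⊆-coSingleton X (proj₁ U) (avoids n le)) 𝓗U

    ⋂⇔∉ : ∀ (H : Carrier (𝒪 (𝒪 X))) x → (⋂ X H x ≡ true) ⇔ (¬ proj₁ H X∖｛ x ｝ ≡ true)
    ⋂⇔∉ (H , H-up , _) x = mk⇔
      (λ x∈⋂ Hx → decide≡true⇒ (decide≡true⇒ x∈⋂ X∖｛ x ｝ Hx) refl)
      (λ Hx̸ → ⇒decide≡true λ U HU → dne λ x∉U → Hx̸ (H-up U X∖｛ x ｝ (⊆-coSingleton X (proj₁ U) x∉U) HU))

    co⋂⇔∈ : ∀ (H : Carrier (𝒪 (𝒪 X))) x → (co⋂ X H x ≡ true) ⇔ (proj₁ H X∖｛ x ｝ ≡ true)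
    co⋂⇔∈ H x = mk⇔ (λ e → dne λ Hx̸ → decide≡true⇒ e (from (⋂⇔∉ H x) Hx̸))
                    (λ Hx → ⇒decide≡true λ x∈⋂ → to (⋂⇔∉ H x) x∈⋂ Hx)

    co⋂-open : ∀ H → Open X (co⋂ X H)
    co⋂-open H@(𝓗 , 𝓗-open) =
      Open-resp T (coSingleton-continuous 𝓗 𝓗-open) (co⋂⇔∈ H)

    co⋂-continuous : Continuous (𝒪 (𝒪 X)) (𝒪 X) (λ H → co⋂ X H , co⋂-open H)
    co⋂-continuous = ωScott-continuous _ mono union
      where
      mono : ∀ H H′ → proj₁ H ⊆ proj₁ H′ → co⋂ X H ⊆ co⋂ X H′
      mono H H′ H⊆H′ x e = from (co⋂⇔∈ H′ x) (H⊆H′ _ (to (co⋂⇔∈ H x) e))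
      union : ∀ D H → IsUnion {𝒪 X} D H → IsUnion {X} (λ n → co⋂ X (D n) , co⋂-open (D n)) (co⋂ X H , co⋂-open H)
      union D H D∪ x = mk⇔
        (λ e → let (n , Dn) = to (D∪ X∖｛ x ｝) (to (co⋂⇔∈ H x) e) in n , from (co⋂⇔∈ (D n) x) Dn)
        (λ (n , e) → from (co⋂⇔∈ H x) (from (D∪ X∖｛ x ｝) (n , to (co⋂⇔∈ (D n) x) e)))

    ⋂-limit : ∀ (Hs : ℕ → Carrier (𝒪 (𝒪 X))) H∞ (xs : ℕ → Carrier X) x∞ →
              Converges (𝒪 (𝒪 X)) Hs H∞ → Converges X xs x∞ →
              (∀ n → ⋂ X (Hs n) (xs n) ≡ true) → ⋂ X H∞ x∞ ≡ true
    ⋂-limit Hs H∞@(𝓗∞ , 𝓗∞-open) xs x∞ Hs→H∞ xs→x∞ xs∈⋂ = from (⋂⇔∉ H∞ x∞) λ 𝓗∞x →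
      let (U , 𝓗∞U , avoids) = Avoiding.ωScottOpen-avoids-tail xs→x∞ 𝓗∞ 𝓗∞-open 𝓗∞x
          (n , late)        = Eventually-∧ (Hs→H∞ _ (point-ωScottOpen (𝒪 X) U) 𝓗∞U) avoids
          (U∈Hn , xn∉U)     = late n ≤-refl
      in to (⋂⇔∉ (Hs n) (xs n)) (xs∈⋂ n)
            (proj₁ (proj₂ (Hs n)) U X∖｛ xs n ｝ (⊆-coSingleton X (proj₁ U) xn∉U) U∈Hn)

    neq-seqContinuous : SeqContinuous (XxX X) Sierpinski (neq X)
    neq-seqContinuous = Open⇒SeqContinuous-Sierpinski
      (SeqClosed⇒SeqOpen-complement (diagonal-SeqClosed X hd T))

lemma2p4 : (lem : ExcludedMiddle 0ℓ) → let open Classical lem in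
    (X : Space) → IsTopology X → IsSequential X → SeqHausdorff X →
    SeqContinuous (XxX X) Sierpinski (neq X)
    × Σ (∀ x → Open X (coSingleton X x))
        (λ h → Continuous X (𝒪 X) (λ x → coSingleton X x , h x))
    × Σ (∀ H → Open X (co⋂ X H))
        (λ h → Continuous (𝒪 (𝒪 X)) (𝒪 X) (λ H → co⋂ X H , h H))
    × (∀ (Hs : ℕ → Carrier (𝒪 (𝒪 X))) (H∞ : Carrier (𝒪 (𝒪 X)))
         (xs : ℕ → Carrier X) (x∞ : Carrier X) →
         Converges (𝒪 (𝒪 X)) Hs H∞ → Converges X xs x∞ →
         (∀ n → ⋂ X (Hs n) (xs n) ≡ true) → ⋂ X H∞ x∞ ≡ true)
lemma2p4 lem X T sq hd =
  neq-seqContinuous , (coSingleton-open , coSingleton-continuous) , (co⋂-open , co⋂-continuous) , ⋂-limit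
  where open WithExcludedMiddle.Sequential lem X T sq hd
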